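{- Let $G=(V,E)$ be a graph with neighborhood diversity $r$, let $V=\bigsqcup_{i\in[r]} T_i$ be a neighborhood decomposition of $G$ into $r$ classes, and let $\mathcal{C}:V\to[c]$ be a coloring. Then there is a minimum consistent subset $S$ for $(G,\mathcal{C})$ such that for every $i\in[r]$ and every $j\in[c]$, $$|T_i\cap \mathcal{C}^{ -1}(j)\cap S|\in\{0,\;1,\;|T_i\cap\mathcal{C}^{ -1}(j)|\}.$$
   Context: Distances $d(u,v)$ are shortest-path distances in $G$; for $U\subseteq V$, $d(v,U)=\min_{u\in U}d(v,u)$ and $\mathrm{NN}(v,U)=\{u\in U: d(v,u)=d(v,U)\}$. A set $S\subseteq V$ is a consistent subset for $(G,\mathcal{C})$ if for every $v\in V$, $\mathcal{C}(v)\in\mathcal{C}(\mathrm{NN}(v,S))$; a minimum consistent subset is one of minimum cardinality. Two vertices $u,v$ are of the same type if $N(v)\setminus\{u\}=N(u)\setminus\{v\}$. A neighborhood decomposition is a partition of $V$ into classes of pairwise same-type vertices; the neighborhood diversity is the minimum number of classes of such a partition. -}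

module Defs where

open import Data.Nat using (ℕ; zero; suc; _≤_)
open import Data.Fin using (Fin; _≟_)
open import Data.Bool using (Bool; true; false; _∧_)
open import Data.Vec using (tabulate)
open import Data.Fin.Subset using (Subset; _∈_; _∩_; ∣_∣)
open import Data.Product using (Σ; ∃; _×_; _,_)
open import Data.Sum using (_⊎_)
open import Function.Bundles using (_⇔_)
open import Relation.Binary.PropositionalEquality using (_≡_; _≢_)
open import Relation.Nullary.Decidable using (⌊_⌋)

record Graph (n : ℕ) : Set where
  field
    adj     : Fin n → Fin n → Bool
    sym     : ∀ u v → adj u v ≡ adj v u
    irrefl  : ∀ v → adj v v ≡ false

open Graph public

_∈N[_]_ : ∀ {n} → Fin n → Graph n → Fin n → Set
w ∈N[ G ] v = adj G v w ≡ true

data Walk {n : ℕ} (G : Graph n) : Fin n → Fin n → ℕ → Set where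
  nil  : ∀ {u} → Walk G u u zero
  cons : ∀ {u w v k} → adj G u w ≡ true → Walk G w v k → Walk G u v (suc k)

-- d(v,u) ≤ d(v,u') in ℕ ∪ {∞} (d = shortest-path distance, ∞ if unreachable):
-- every walk from v to u' of length k is matched by a walk from v to u of length ≤ k.
DistLe : ∀ {n} → Graph n → Fin n → Fin n → Fin n → Set
DistLe G v u u' = ∀ k → Walk G v u' k → Σ ℕ (λ k' → k' ≤ k × Walk G v u k')

InNN : ∀ {n} → Graph n → Fin n → Subset n → Fin n → Set
InNN G v U u = u ∈ U × (∀ u' → u' ∈ U → DistLe G v u u')

Consistent : ∀ {n c} → Graph n → (Fin n → Fin c) → Subset n → Set
Consistent G C S = ∀ v → Σ (Fin _) (λ u → InNN G v S u × C u ≡ C v)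

MinConsistent : ∀ {n c} → Graph n → (Fin n → Fin c) → Subset n → Set
MinConsistent G C S =
  Consistent G C S × (∀ S' → Consistent G C S' → ∣ S ∣ ≤ ∣ S' ∣)

SameType : ∀ {n} → Graph n → Fin n → Fin n → Set
SameType G u v = ∀ w → ((w ∈N[ G ] v × w ≢ u) ⇔ (w ∈N[ G ] u × w ≢ v))

-- A neighborhood decomposition into r classes, given as the class map T : V → [r]
-- (class T_i = T⁻¹(i)); it is a partition into r (nonempty) classes, each class
-- consisting of pairwise same-type vertices.
IsNbhdDecomposition : ∀ {n} → Graph n → (r : ℕ) → (Fin n → Fin r) → Set
IsNbhdDecomposition {n} G r T =
  (∀ (i : Fin r) → Σ (Fin n) (λ v → T v ≡ i)) ×
  (∀ u v → T u ≡ T v → SameType G u v)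

NbhdDiversity : ∀ {n} → Graph n → ℕ → Set
NbhdDiversity {n} G r =
  Σ (Fin n → Fin r) (IsNbhdDecomposition G r) ×
  (∀ r' → (T' : Fin n → Fin r') → IsNbhdDecomposition G r' T' → r ≤ r')

ClassColor : ∀ {n r c} → (Fin n → Fin r) → (Fin n → Fin c) → Fin r → Fin c → Subset n
ClassColor T C i j = tabulate (λ v → ⌊ T v ≟ i ⌋ ∧ ⌊ C v ≟ j ⌋)

module Submission where

-- Every minimum consistent subset S already has the property.  Swapping two vertices of the
-- same type is a graph automorphism, so it preserves distances.  If S contained two vertices u, w
-- of the same class and colour but missed a third one x of that class and colour, then S - u
-- would still be consistent: a vertex whose nearest representative was u is equally close to w,
-- and u itself sees S - u exactly as x does.  A minimum consistent subset exists because
-- consistency is decidable (nearest neighbours only need walks of length < n).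

open import Defs hiding (sym)
open import Data.Nat using (ℕ; zero; suc; _+_; _≤_; _<_; z≤n; s≤s; _<?_; _≤?_) renaming (_≟_ to _≟ℕ_)
open import Data.Nat.Properties
open import Data.Nat.Induction using (<-rec)
open import Data.Fin using (Fin; toℕ; fromℕ<) renaming (zero to fzero; suc to fsuc; _≟_ to _≟F_; _<_ to _<ᶠ_)
open import Data.Fin.Properties using (any?; all?; pigeonhole; toℕ-fromℕ<; toℕ≤pred[n])
open import Data.Fin.Subset using (Subset; _∩_; ∣_∣; _∈_; _∉_; _─_; _-_; ⁅_⁆; ⊤)
open import Data.Fin.Subset.Properties
  using (_∈?_; anySubset?; nonempty?; ∈⊤; ∣p∣≤n; x∈p⇒∣p-x∣<∣p∣; p─q⊆p; x∈p∧x≢y⇒x∈p-y; x∈⁅x⁆;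
         x∈p∩q⁻; x∈p∩q⁺; p⊆q⇒∣p∣≤∣q∣; Empty-unique; ∣⊥∣≡0; ∣⁅x⁆∣≡1)
open import Data.Vec using (_∷_; there)
open import Data.Vec.Properties using ([]=⇒lookup; lookup∘tabulate)
open import Data.Bool using (true; _∧_)
import Data.Bool as Bool
open import Data.Bool.Properties using (⇔→≡; T-≡; T-∧) renaming (_≟_ to _≟B_)
open import Data.Product using (Σ; _×_; _,_; proj₁; proj₂)
open import Data.Sum using (_⊎_; inj₁; inj₂)
open import Function.Bundles using (Equivalence; mk⇔)
open import Relation.Binary.PropositionalEquality
open import Relation.Nullary using (Dec; yes; no; contradiction)
open import Relation.Nullary.Decidable
  using (_×-dec_; _→-dec_; _⊎-dec_; ¬?; map′; decidable-stable; ⌊_⌋; toWitness)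
open import Data.Empty using (⊥)
open import Function using (_∘_)

module Walks {n : ℕ} (G : Graph n) where

  _++ʷ_ : ∀ {a b c k l} → Walk G a b k → Walk G b c l → Walk G a c (k + l)
  nil      ++ʷ q = q
  cons e p ++ʷ q = cons e (p ++ʷ q)

  vertexAt : ∀ {v x k} → Walk G v x k → Fin (suc k) → Fin n
  vertexAt {v} p          fzero    = v
  vertexAt     (cons e p) (fsuc i) = vertexAt p i

  prefix : ∀ {v x k} (p : Walk G v x k) (i : Fin (suc k)) → Walk G v (vertexAt p i) (toℕ i)
  prefix p          fzero    = nil
  prefix (cons e p) (fsuc i) = cons e (prefix p i)

  suffix : ∀ {v x k} (p : Walk G v x k) (i : Fin (suc k)) →
           Σ ℕ λ l → l + toℕ i ≡ k × Walk G (vertexAt p i) x l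
  suffix {k = k} p          fzero    = k , +-identityʳ k , p
  suffix         (cons e p) (fsuc i) with suffix p i
  ... | l , l+i≡k , q = l , trans (+-suc l (toℕ i)) (cong suc l+i≡k) , q

  Walk≤ : Fin n → Fin n → ℕ → Set
  Walk≤ v y k = Σ ℕ λ k' → k' ≤ k × Walk G v y k'

  cut-cycle : ∀ {v x k} (p : Walk G v x k) {i j : Fin (suc k)} → i <ᶠ j →
              vertexAt p i ≡ vertexAt p j → Σ ℕ λ m → m < k × Walk G v x m
  cut-cycle {k = k} p {i} {j} i<j same with suffix p j
  ... | l , l+j≡k , q = toℕ i + l , shorter , prefix p i ++ʷ subst (λ z → Walk G z _ l) (sym same) q
    where
      shorter : toℕ i + l < k
      shorter = subst (toℕ i + l <_) (trans (+-comm (toℕ j) l) l+j≡k) (+-monoˡ-< l i<j)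

  ShortWalk≤ : Fin n → Fin n → ℕ → Set
  ShortWalk≤ v x k = Σ ℕ λ k' → k' ≤ k × k' < n × Walk G v x k'

  -- A walk of length ≥ n repeats a vertex (pigeonhole), so it contains a cycle to cut out.
  shortcut : ∀ k {v x} → Walk G v x k → ShortWalk≤ v x k
  shortcut = <-rec _ step
    where
      step : ∀ k → (∀ {m} → m < k → ∀ {v x} → Walk G v x m → ShortWalk≤ v x m) →
             ∀ {v x} → Walk G v x k → ShortWalk≤ v x k
      step k rec p with k <? n
      ... | yes k<n = k , ≤-refl , k<n , p
      ... | no  k≮n with pigeonhole (s≤s (≮⇒≥ k≮n)) (vertexAt p)
      ... | i , j , i<j , same with cut-cycle p i<j same
      ... | m , m<k , q with rec m<k q
      ... | k' , k'≤m , k'<n , r = k' , ≤-trans k'≤m (<⇒≤ m<k) , k'<n , r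

  walk? : ∀ k v y → Dec (Walk G v y k)
  walk? zero v y with v ≟F y
  ... | yes refl = yes nil
  ... | no  v≢y  = no λ { nil → v≢y refl }
  walk? (suc k) v y with any? (λ w → (adj G v w ≟B true) ×-dec walk? k w y)
  ... | yes (w , e , p) = yes (cons e p)
  ... | no  ¬step       = no λ { (cons {w = w} e p) → ¬step (w , e , p) }

  walk≤? : ∀ k v y → Dec (Walk≤ v y k)
  walk≤? k v y = map′
    (λ { (i , p) → toℕ i , toℕ≤pred[n] i , p })
    (λ { (k' , k'≤k , p) → fromℕ< (s≤s k'≤k) , subst (Walk G v y) (sym (toℕ-fromℕ< (s≤s k'≤k))) p })
    (any? λ (i : Fin (suc k)) → walk? (toℕ i) v y)

  -- By shortcut, DistLe only has to be checked for walks of length < n.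
  distLe? : ∀ v u u' → Dec (DistLe G v u u')
  distLe? v u u' = map′ bounded⇒distLe (λ d k → d (toℕ k))
    (all? λ k → walk? (toℕ k) v u' →-dec walk≤? (toℕ k) v u)
    where
      bounded⇒distLe : (∀ (k : Fin n) → Walk G v u' (toℕ k) → Walk≤ v u (toℕ k)) → DistLe G v u u'
      bounded⇒distLe d k p with shortcut k p
      ... | k' , k'≤k , k'<n , p'
          with d (fromℕ< k'<n) (subst (Walk G v u') (sym (toℕ-fromℕ< k'<n)) p')
      ... | k'' , k''≤ , q = k'' , ≤-trans k''≤ (≤-trans (≤-reflexive (toℕ-fromℕ< k'<n)) k'≤k) , q

open Walks using (distLe?)

distLe-self : ∀ {n} {G : Graph n} {v u} → DistLe G v v u
distLe-self _ _ = 0 , z≤n , nil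

distLe-trans : ∀ {n} {G : Graph n} {v a b c} → DistLe G v a b → DistLe G v b c → DistLe G v a c
distLe-trans a≤b b≤c k p with b≤c k p
... | k₁ , k₁≤k , q with a≤b k₁ q
... | k₂ , k₂≤k₁ , r = k₂ , ≤-trans k₂≤k₁ k₁≤k , r

consistent? : ∀ {n c} (G : Graph n) (C : Fin n → Fin c) (S : Subset n) → Dec (Consistent G C S)
consistent? G C S = all? λ v → any? λ u →
  ((u ∈? S) ×-dec all? (λ u' → (u' ∈? S) →-dec distLe? G v u u')) ×-dec (C u ≟F C v)

⊤-consistent : ∀ {n c} (G : Graph n) (C : Fin n → Fin c) → Consistent G C ⊤
⊤-consistent G C v = v , (∈⊤ , λ _ _ → distLe-self) , refl

minimum-exists : ∀ {n} {P : Subset n → Set} → (∀ S → Dec (P S)) → ∀ S → P S →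
                 Σ (Subset n) λ M → P M × (∀ S' → P S' → ∣ M ∣ ≤ ∣ S' ∣)
minimum-exists {n} {P} P? S PS = descend n S PS (∣p∣≤n S)
  where
    descend : ∀ m S → P S → ∣ S ∣ ≤ m → Σ (Subset n) λ M → P M × (∀ S' → P S' → ∣ M ∣ ≤ ∣ S' ∣)
    descend zero    S PS ∣S∣≤0 = S , PS , λ _ _ → ≤-trans ∣S∣≤0 z≤n
    descend (suc m) S PS ∣S∣≤m+1 with anySubset? (λ S' → P? S' ×-dec (∣ S' ∣ ≤? m))
    ... | yes (S' , PS' , ∣S'∣≤m) = descend m S' PS' ∣S'∣≤m
    ... | no  ¬smaller = S , PS , minimal
      where
        minimal : ∀ S' → P S' → ∣ S ∣ ≤ ∣ S' ∣
        minimal S' PS' with ∣ S ∣ ≤? ∣ S' ∣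
        ... | yes ≤ = ≤
        ... | no  ≰ = contradiction (S' , PS' , ≤-pred (≤-trans (≰⇒> ≰) ∣S∣≤m+1)) ¬smaller

module Automorphism {n} {G : Graph n} {σ : Fin n → Fin n}
  (σ-adj : ∀ p q → adj G (σ p) (σ q) ≡ adj G p q) (σ-involutive : ∀ y → σ (σ y) ≡ y) where

  walk-map : ∀ {p q k} → Walk G p q k → Walk G (σ p) (σ q) k
  walk-map nil        = nil
  walk-map (cons e r) = cons (trans (σ-adj _ _) e) (walk-map r)

  distLe-map : ∀ {v s t} → DistLe G v s t → DistLe G (σ v) (σ s) (σ t)
  distLe-map {v} {s} {t} d k q
    with d k (subst₂ (λ a b → Walk G a b k) (σ-involutive v) (σ-involutive t) (walk-map q))
  ... | k' , k'≤k , r = k' , k'≤k , walk-map r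

module Swap {n} (a b : Fin n) where

  swap : Fin n → Fin n
  swap y with y ≟F a | y ≟F b
  ... | yes _ | _     = b
  ... | no  _ | yes _ = a
  ... | no  _ | no  _ = y

  swap-a : swap a ≡ b
  swap-a with a ≟F a
  ... | yes _   = refl
  ... | no  a≢a = contradiction refl a≢a

  swap-b : swap b ≡ a
  swap-b with b ≟F a | b ≟F b
  ... | yes b≡a | _       = b≡a
  ... | no  _   | yes _   = refl
  ... | no  _   | no  b≢b = contradiction refl b≢b

  swap-other : ∀ {y} → y ≢ a → y ≢ b → swap y ≡ y
  swap-other {y} y≢a y≢b with y ≟F a | y ≟F b
  ... | yes y≡a | _       = contradiction y≡a y≢a
  ... | no  _   | yes y≡b = contradiction y≡b y≢b
  ... | no  _   | no  _   = refl

  data SwapCase (y : Fin n) : Set where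
    is-a  : y ≡ a → SwapCase y
    is-b  : y ≡ b → SwapCase y
    other : y ≢ a → y ≢ b → SwapCase y

  swapCase : ∀ y → SwapCase y
  swapCase y with y ≟F a | y ≟F b
  ... | yes y≡a | _       = is-a y≡a
  ... | no  y≢a | yes y≡b = is-b y≡b
  ... | no  y≢a | no  y≢b = other y≢a y≢b

  swap-involutive : ∀ y → swap (swap y) ≡ y
  swap-involutive y with swapCase y
  ... | is-a refl       = trans (cong swap swap-a) swap-b
  ... | is-b refl       = trans (cong swap swap-b) swap-a
  ... | other y≢a y≢b = trans (cong swap (swap-other y≢a y≢b)) (swap-other y≢a y≢b)

  module _ {G : Graph n} (a~b : SameType G a b) where

    adj-a≡adj-b : ∀ q → q ≢ a → q ≢ b → adj G a q ≡ adj G b q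
    adj-a≡adj-b q q≢a q≢b = ⇔→≡ (mk⇔
      (λ e → proj₁ (Equivalence.from (a~b q) (e , q≢b)))
      (λ e → proj₁ (Equivalence.to (a~b q) (e , q≢a))))

    swap-adj : ∀ p q → adj G (swap p) (swap q) ≡ adj G p q
    swap-adj p q with swapCase p | swapCase q
    ... | is-a refl | is-a refl rewrite swap-a = trans (irrefl G b) (sym (irrefl G a))
    ... | is-a refl | is-b refl rewrite swap-a | swap-b = Graph.sym G b a
    ... | is-a refl | other q≢a q≢b rewrite swap-a | swap-other q≢a q≢b = sym (adj-a≡adj-b q q≢a q≢b)
    ... | is-b refl | is-a refl rewrite swap-a | swap-b = Graph.sym G a b
    ... | is-b refl | is-b refl rewrite swap-b = trans (irrefl G a) (sym (irrefl G b))
    ... | is-b refl | other q≢a q≢b rewrite swap-b | swap-other q≢a q≢b = adj-a≡adj-b q q≢a q≢b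
    ... | other p≢a p≢b | is-a refl rewrite swap-a | swap-other p≢a p≢b =
          trans (Graph.sym G p b) (trans (sym (adj-a≡adj-b p p≢a p≢b)) (Graph.sym G a p))
    ... | other p≢a p≢b | is-b refl rewrite swap-b | swap-other p≢a p≢b =
          trans (Graph.sym G p a) (trans (adj-a≡adj-b p p≢a p≢b) (Graph.sym G b p))
    ... | other p≢a p≢b | other q≢a q≢b rewrite swap-other p≢a p≢b | swap-other q≢a q≢b = refl

    open Automorphism {G = G} swap-adj swap-involutive public

x∈p─q⇒x∉q : ∀ {n} {x : Fin n} (p q : Subset n) → x ∈ p ─ q → x ∉ q
x∈p─q⇒x∉q (_ ∷ p) (_ ∷ q) (there x∈p─q) (there x∈q) = x∈p─q⇒x∉q p q x∈p─q x∈q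

x∈p-y⇒x≢y : ∀ {n} {x y : Fin n} (p : Subset n) → x ∈ p - y → x ≢ y
x∈p-y⇒x≢y {y = y} p x∈p-y refl = x∈p─q⇒x∉q p ⁅ y ⁆ x∈p-y (x∈⁅x⁆ y)

module _ {n c} {G : Graph n} {C : Fin n → Fin c} {S : Subset n} (S-consistent : Consistent G C S)
  {u w x : Fin n} (u∈S : u ∈ S) (w∈S : w ∈ S) (u≢w : u ≢ w) (x∉S : x ∉ S)
  (u~w : SameType G u w) (u~x : SameType G u x) (Cw≡Cu : C w ≡ C u) (Cx≡Cu : C x ≡ C u) where

  private
    ∈S-u⇒∈S : ∀ {y} → y ∈ S - u → y ∈ S
    ∈S-u⇒∈S = p─q⊆p S ⁅ u ⁆

    ∈S-u⇒≢x : ∀ {y} → y ∈ S - u → y ≢ x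
    ∈S-u⇒≢x y∈ refl = x∉S (∈S-u⇒∈S y∈)

    -- A nearest representative u of v is replaced by w: swapping u and w fixes v and maps u to w.
    consistent-at-other : ∀ v → v ≢ u → Σ (Fin n) λ t → InNN G v (S - u) t × C t ≡ C v
    consistent-at-other v v≢u with S-consistent v
    ... | t , (t∈S , t-nearest) , Ct≡Cv with t ≟F u
    ...   | no  t≢u  = t , (x∈p∧x≢y⇒x∈p-y t∈S t≢u , λ s s∈ → t-nearest s (∈S-u⇒∈S s∈)) , Ct≡Cv
    ...   | yes refl = w , (x∈p∧x≢y⇒x∈p-y w∈S (u≢w ∘ sym) , w-nearest) , trans Cw≡Cu Ct≡Cv
      where
        open Swap u w
        w≤u : DistLe G v w u
        w≤u with v ≟F w
        ... | yes refl = distLe-self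
        ... | no  v≢w  = λ k p → k , ≤-refl ,
                subst₂ (λ a b → Walk G a b k) (swap-other v≢u v≢w) swap-a (walk-map u~w p)
        w-nearest : ∀ s → s ∈ S - u → DistLe G v w s
        w-nearest s s∈ = distLe-trans w≤u (t-nearest s (∈S-u⇒∈S s∈))

    consistent-at-u : Σ (Fin n) λ t → InNN G u (S - u) t × C t ≡ C u
    consistent-at-u with consistent-at-other x (λ x≡u → x∉S (subst (_∈ S) (sym x≡u) u∈S))
    ... | t , (t∈ , t-nearest) , Ct≡Cx = t , (t∈ , t-nearest-from-u) , trans Ct≡Cx Cx≡Cu
      where
        open Swap u x
        swap-fixes : ∀ {y} → y ∈ S - u → swap y ≡ y
        swap-fixes y∈ = swap-other (x∈p-y⇒x≢y S y∈) (∈S-u⇒≢x y∈)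
        t-nearest-from-u : ∀ s → s ∈ S - u → DistLe G u t s
        t-nearest-from-u s s∈ = subst₂ (λ a b → DistLe G a b s) swap-b (swap-fixes t∈)
          (subst (DistLe G (swap x) (swap t)) (swap-fixes s∈) (distLe-map u~x (t-nearest s s∈)))

  consistent-without : Consistent G C (S - u)
  consistent-without v with v ≟F u
  ... | yes refl = consistent-at-u
  ... | no  v≢u  = consistent-at-other v v≢u

∈ClassColor⇒ : ∀ {n r c} {T : Fin n → Fin r} {C : Fin n → Fin c} {i j x} →
               x ∈ ClassColor T C i j → T x ≡ i × C x ≡ j
∈ClassColor⇒ {T = T} {C} {i} {j} {x} x∈ = toWitness (proj₁ both) , toWitness (proj₂ both)
  where
    entry≡true : ⌊ T x ≟F i ⌋ ∧ ⌊ C x ≟F j ⌋ ≡ true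
    entry≡true = trans (sym (lookup∘tabulate (λ v → ⌊ T v ≟F i ⌋ ∧ ⌊ C v ≟F j ⌋) x)) ([]=⇒lookup x∈)
    both : Bool.T ⌊ T x ≟F i ⌋ × Bool.T ⌊ C x ≟F j ⌋
    both = Equivalence.to T-∧ (Equivalence.from T-≡ entry≡true)

2≤∣p∣⇒distinct : ∀ {n} (p : Subset n) → 2 ≤ ∣ p ∣ →
                 Σ (Fin n) λ u → Σ (Fin n) λ w → u ∈ p × w ∈ p × u ≢ w
2≤∣p∣⇒distinct {n} p 2≤∣p∣ with nonempty? p
... | no  p-empty =
      contradiction (subst (2 ≤_) (trans (cong ∣_∣ (Empty-unique p-empty)) (∣⊥∣≡0 n)) 2≤∣p∣) λ ()
... | yes (u , u∈p) with nonempty? (p - u)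
...   | yes (w , w∈p-u) = u , w , u∈p , p─q⊆p p ⁅ u ⁆ w∈p-u , λ u≡w → x∈p-y⇒x≢y p w∈p-u (sym u≡w)
...   | no  p-u-empty   =
        contradiction (≤-trans 2≤∣p∣ (≤-trans (p⊆q⇒∣p∣≤∣q∣ p⊆⁅u⁆) (≤-reflexive (∣⁅x⁆∣≡1 u)))) λ { (s≤s ()) }
  where
    p⊆⁅u⁆ : ∀ {y} → y ∈ p → y ∈ ⁅ u ⁆
    p⊆⁅u⁆ {y} y∈p with y ≟F u
    ... | yes refl = x∈⁅x⁆ u
    ... | no  y≢u  = contradiction (y , x∈p∧x≢y⇒x∈p-y y∈p y≢u) p-u-empty

∣p∩q∣≢∣p∣⇒∉ : ∀ {n} (p q : Subset n) → ∣ p ∩ q ∣ ≢ ∣ p ∣ → Σ (Fin n) λ x → x ∈ p × x ∉ q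
∣p∩q∣≢∣p∣⇒∉ p q ∣p∩q∣≢∣p∣ with any? (λ x → (x ∈? p) ×-dec ¬? (x ∈? q))
... | yes witness  = witness
... | no  ¬witness =
      contradiction (≤-antisym (p⊆q⇒∣p∣≤∣q∣ (proj₁ ∘ x∈p∩q⁻ p q)) (p⊆q⇒∣p∣≤∣q∣ p⊆p∩q)) ∣p∩q∣≢∣p∣
  where
    p⊆p∩q : ∀ {y} → y ∈ p → y ∈ p ∩ q
    p⊆p∩q {y} y∈p with y ∈? q
    ... | yes y∈q = x∈p∩q⁺ (y∈p , y∈q)
    ... | no  y∉q = contradiction (y , y∈p , y∉q) ¬witness

≢0∧≢1⇒2≤ : ∀ {k} → k ≢ 0 → k ≢ 1 → 2 ≤ k
≢0∧≢1⇒2≤ {zero}        k≢0 _   = contradiction refl k≢0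
≢0∧≢1⇒2≤ {suc zero}    _   k≢1 = contradiction refl k≢1
≢0∧≢1⇒2≤ {suc (suc _)} _   _   = s≤s (s≤s z≤n)

ZeroOneOrAll : ∀ {n} → Subset n → Subset n → Set
ZeroOneOrAll A S = (∣ A ∩ S ∣ ≡ 0) ⊎ (∣ A ∩ S ∣ ≡ 1) ⊎ (∣ A ∩ S ∣ ≡ ∣ A ∣)

zeroOneOrAll? : ∀ {n} (A S : Subset n) → Dec (ZeroOneOrAll A S)
zeroOneOrAll? A S = (∣ A ∩ S ∣ ≟ℕ 0) ⊎-dec (∣ A ∩ S ∣ ≟ℕ 1) ⊎-dec (∣ A ∩ S ∣ ≟ℕ ∣ A ∣)

minConsistent-zeroOneOrAll : ∀ {n r c} {G : Graph n} {T : Fin n → Fin r} {C : Fin n → Fin c}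
  {S : Subset n} →
  (∀ u v → T u ≡ T v → SameType G u v) → MinConsistent G C S →
  ∀ i j → ZeroOneOrAll (ClassColor T C i j) S
minConsistent-zeroOneOrAll {T = T} {C} {S} classes-same-type (S-consistent , S-minimum) i j =
  decidable-stable (zeroOneOrAll? A S) λ ¬z →
    redundant (2≤∣p∣⇒distinct (A ∩ S) (≢0∧≢1⇒2≤ (¬z ∘ inj₁) (¬z ∘ inj₂ ∘ inj₁)))
              (∣p∩q∣≢∣p∣⇒∉ A S (¬z ∘ inj₂ ∘ inj₂))
  where
    A = ClassColor T C i j
    same-class-colour : ∀ {y z} → y ∈ A → z ∈ A → T y ≡ T z × C y ≡ C z
    same-class-colour y∈A z∈A with ∈ClassColor⇒ {T = T} y∈A | ∈ClassColor⇒ {T = T} z∈A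
    ... | Ty≡i , Cy≡j | Tz≡i , Cz≡j = trans Ty≡i (sym Tz≡i) , trans Cy≡j (sym Cz≡j)

    redundant : (Σ (Fin _) λ u → Σ (Fin _) λ w → u ∈ A ∩ S × w ∈ A ∩ S × u ≢ w) →
                (Σ (Fin _) λ x → x ∈ A × x ∉ S) → ⊥
    redundant (u , w , u∈A∩S , w∈A∩S , u≢w) (x , x∈A , x∉S)
      with x∈p∩q⁻ A S u∈A∩S | x∈p∩q⁻ A S w∈A∩S
    ... | u∈A , u∈S | w∈A , w∈S =
      <⇒≱ (x∈p⇒∣p-x∣<∣p∣ u∈S) (S-minimum (S - u) (consistent-without S-consistent u∈S w∈S u≢w x∉S
        (classes-same-type u w (proj₁ (same-class-colour u∈A w∈A)))
        (classes-same-type u x (proj₁ (same-class-colour u∈A x∈A)))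
        (proj₂ (same-class-colour w∈A u∈A)) (proj₂ (same-class-colour x∈A u∈A))))

mainTheorem3 : ∀ {n : ℕ} (G : Graph n) (r c : ℕ) (T : Fin n → Fin r) (C : Fin n → Fin c) →
    NbhdDiversity G r → IsNbhdDecomposition G r T →
    Σ (Subset n) (λ S → MinConsistent G C S ×
      (∀ (i : Fin r) (j : Fin c) →
        (∣ ClassColor T C i j ∩ S ∣ ≡ 0) ⊎ (∣ ClassColor T C i j ∩ S ∣ ≡ 1) ⊎
        (∣ ClassColor T C i j ∩ S ∣ ≡ ∣ ClassColor T C i j ∣)))
mainTheorem3 G r c T C _ (_ , classes-same-type)
  with minimum-exists (consistent? G C) ⊤ (⊤-consistent G C)
... | S , S-minimum-consistent =
  S , S-minimum-consistent , minConsistent-zeroOneOrAll classes-same-type S-minimum-consistent
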